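{- Let $n\ge 2$ and $k\ge 0$, and let $D$ be the weighted strand diagram consisting of a single crossing of size $n$ with no dots. Then \[ \operatorname{tr}^{\,n-1}(\partial_k D)=(n-2)!\sum_{i=2}^{n}\Big[(i-1)\,h_{n-i}\,\partial_{k+i-1}S+(k+i-n)\,h_{k+i-1}\,\partial_{n-i}S\Big], \] where $S$ denotes the single strand with no dots.
   Context: Let $\Lambda$ be the ring of symmetric functions, $h_m$ the complete homogeneous symmetric functions ($h_0=1$) and $p_m$ the power sum symmetric functions. A weighted crossing of size $m\ge1$ is a tuple $(a_1,\dots,a_m)$ of nonnegative integers, thought of as a single crossing of $m$ strands with $a_i$ dots decorating the top of strand $i$; for $m=1$ it is a single strand with $a_1$ dots, denoted $S^{a_1}$ (and $S=S^0$). We work in the free $\Lambda$-module with basis the weighted crossings. The trace $\operatorname{tr}$ is the $\Lambda$-linear map defined on a weighted crossing of size $m\ge2$ by removing the last strand and either multiplying by $p_{a_m+1}$ or adding $a_m+1$ dots to one of the remaining strands: \[\operatorname{tr}(a_1,\dots,a_m)=p_{a_m+1}(a_1,\dots,a_{m-1})+\sum_{i=1}^{m-1}(a_1,\dots,a_i+a_m+1,\dots,a_{m-1}).\] (On a single strand, $\operatorname{tr}(S^{a})=p_{a+1}$.) $\operatorname{tr}^{n-1}$ is the $(n-1)$-fold iterate. For a weighted diagram $D$, $D^j$ denotes $D$ with $j$ extra dots on its right-most strand, and $\partial_kD=\sum_{j=0}^{k}h_{k-j}D^j$; in particular $\partial_k S=\sum_{j=0}^k h_{k-j}S^j$. -}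

module Defs where


open import Algebra.Bundles using (CommutativeRing)
open import Data.Nat using (ℕ; zero; suc; _∸_; _!) renaming (_+_ to _+ℕ_)
open import Data.Nat.Properties using () renaming (_≟_ to _≟ℕ_)
open import Data.List using (List; []; _∷_; map; foldr; concatMap; replicate; _++_; upTo; unsnoc)
open import Data.List.Properties using (≡-dec)
open import Data.Maybe using (just; nothing)
open import Data.Product using (_×_; _,_)
open import Relation.Nullary using (yes; no)

-- A weighted crossing (a₁,…,aₘ) is a list of dot numbers; the empty list
-- plays the role of the empty diagram (so that tr(S^a) = p_{a+1} · ∅).
Crossing : Set
Crossing = List ℕ

-- Finite sums over ℕ-ranges, ℕ-multiples, power sums relations etc.
-- are all relative to a commutative ring R standing in for Λ.
module _ {c ℓ} (R : CommutativeRing c ℓ) where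
  open CommutativeRing R

  natR : ℕ → Carrier
  natR zero    = 0#
  natR (suc m) = 1# + natR m

  sumR : List Carrier → Carrier
  sumR = foldr _+_ 0#

  Newton : (h p : ℕ → Carrier) → Set ℓ
  Newton h p = ∀ m → natR m * h m ≈ sumR (map (λ t → p (suc t) * h (m ∸ suc t)) (upTo m))

  -- elements of the free R-module on weighted crossings, as finite formal sums
  Mod : Set c
  Mod = List (Carrier × Crossing)

  coeff : Crossing → Mod → Carrier
  coeff d [] = 0#
  coeff d ((r , e) ∷ u) with ≡-dec _≟ℕ_ d e
  ... | yes _ = r + coeff d u
  ... | no  _ = coeff d u

  _≋_ : Mod → Mod → Set ℓ
  u ≋ v = ∀ d → coeff d u ≈ coeff d v

  scale : Carrier → Mod → Mod
  scale r = map (λ { (s , e) → (r * s , e) })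

  addEach : ℕ → Crossing → List Crossing
  addEach d []       = []
  addEach d (y ∷ ys) = ((y +ℕ d) ∷ ys) ∷ map (y ∷_) (addEach d ys)

  trBasis : (p : ℕ → Carrier) → Crossing → Mod
  trBasis p xs with unsnoc xs
  ... | nothing        = []
  ... | just (ys , a)  = (p (suc a) , ys) ∷ map (λ e → (1# , e)) (addEach (suc a) ys)

  tr : (p : ℕ → Carrier) → Mod → Mod
  tr p = concatMap (λ { (r , e) → scale r (trBasis p e) })

  trIter : (p : ℕ → Carrier) → ℕ → Mod → Mod
  trIter p zero    u = u
  trIter p (suc m) u = tr p (trIter p m u)

  ∂D : (h : ℕ → Carrier) → (n k : ℕ) → Mod
  ∂D h n k = map (λ j → (h (k ∸ j) , replicate (n ∸ 1) 0 ++ (j ∷ []))) (upTo (suc k))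

  ∂S : (h : ℕ → Carrier) → (k : ℕ) → Mod
  ∂S h k = map (λ j → (h (k ∸ j) , j ∷ [])) (upTo (suc k))

  rhs : (h : ℕ → Carrier) → (n k : ℕ) → Mod
  rhs h n k = scale (natR ((n ∸ 2) !))
    (concatMap
      (λ i → scale (natR (i ∸ 1) * h (n ∸ i)) (∂S h (k +ℕ i ∸ 1))
          ++ scale ((natR (k +ℕ i) - natR n) * h (k +ℕ i ∸ 1)) (∂S h (n ∸ i)))
      (map (λ t → 2 +ℕ t) (upTo (n ∸ 1))))

-- Fix the target crossing d. Dualising the trace turns the coefficient of d in tr^m u into the
-- linear extension of a function trCoeff m on crossings, computed by removing the last strand:
-- trCoeff (m+1) (xs ∷ʳ a) is p_{a+1} trCoeff m xs plus the sum of trCoeff m over all ways of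
-- adding a+1 dots to one strand of xs. By induction on the number of traced strands, this is
-- symmetric in all strands but the first, so adding dots to one of the m undotted strands of
-- (a, 0^m) gives m times the crossing with those dots on its last strand. For the full traces
-- G m a = trFirst m a of (a, 0^m) and T m a b = trFirstLast m a b of (a, 0^m, b) this yields
--   T m a b = p_{b+1} G m a + G m (a+b+1) + m T (m-1) a (b+1),    G (m+1) a = T m a 0.
-- Convolving with h and using Newton's identities, a simultaneous induction on m shows that
-- G m a = m! ∂_m S^a and that h ⋆ T m a is m! times the bracketed sum of the theorem, shifted
-- by a; the remaining algebra is an exchange identity for the nested convolutions
-- h ⋆ (h ⋆ f (j + 1 + _)) and a telescoping sum.

module Submission where

open import Algebra.Bundles using (CommutativeRing)
open import Algebra.Solver.Ring.AlmostCommutativeRing using (fromCommutativeRing; _-Raw-AlmostCommutative⟶_)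
open import Data.Integer as ℤ using (ℤ; -[1+_]; _⊖_; _◃_; sign; ∣_∣)
import Data.Integer.Properties as ℤ
open import Data.List using (List; []; _∷_; _++_; _∷ʳ_; map; applyUpTo; upTo; concatMap; length; replicate; initLast; _∷ʳ′_; unsnoc)
open import Data.List.Properties using (≡-dec; map-∘; map-cong; length-++; ++-assoc; ∷ʳ-++; length-replicate; map-applyUpTo)
open import Data.Maybe as Maybe using (just)
open import Data.Product using (_,_)
open import Data.Nat as ℕ using (ℕ; zero; suc; _∸_; _!; _≤_; z≤n; s≤s)
import Data.Nat.Properties as ℕ
open import Data.Sign as Sign using (Sign)
open import Relation.Binary.PropositionalEquality as ≡ using (_≡_)
open import Relation.Nullary.Decidable using (yes; no; dec⇒maybe)

open import Defs

initLast-∷ʳ : ∀ {a} {A : Set a} (xs : List A) x → initLast (xs ∷ʳ x) ≡ xs ∷ʳ′ x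
initLast-∷ʳ []       x = ≡.refl
initLast-∷ʳ (y ∷ xs) x rewrite initLast-∷ʳ xs x = ≡.refl

unsnoc-∷ʳ : ∀ {a} {A : Set a} (xs : List A) x → unsnoc (xs ∷ʳ x) ≡ just (xs , x)
unsnoc-∷ʳ xs x rewrite initLast-∷ʳ xs x = ≡.refl

zeros : ℕ → Crossing
zeros n = replicate n 0

zeros-∷ʳ : ∀ n → zeros n ∷ʳ 0 ≡ zeros (suc n)
zeros-∷ʳ zero    = ≡.refl
zeros-∷ʳ (suc n) = ≡.cong (0 ∷_) (zeros-∷ʳ n)

length-∷ʳ : ∀ {a} {A : Set a} (xs : List A) x → length (xs ∷ʳ x) ≡ suc (length xs)
length-∷ʳ xs x = ≡.trans (length-++ xs) (ℕ.+-comm (length xs) 1)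

module Crossings {ℓ₁ ℓ₂} (R : CommutativeRing ℓ₁ ℓ₂) where
  open CommutativeRing R
  open import Algebra.Properties.Ring ring using (-‿involutive; -1*x≈-x; -0#≈0#)
  open import Algebra.Properties.AbelianGroup +-abelianGroup using (⁻¹-∙-comm; xyx⁻¹≈y)
  open import Algebra.Properties.CommutativeSemigroup *-commutativeSemigroup using (interchange; x∙yz≈y∙xz; x∙yz≈yx∙z)
  open import Algebra.Properties.CommutativeSemigroup +-commutativeSemigroup
    using () renaming (interchange to +-interchange; x∙yz≈y∙xz to x+[y+z]≈y+[x+z])
  open import Algebra.Properties.Semiring.Mult.TCOptimised semiring using (_×_; 1+×; ×-homo-+; ×1-homo-*)
  open import Relation.Binary.Reasoning.Setoid setoid

  -- Natural numbers and integers in R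

  ι : ℕ → Carrier
  ι = natR R

  ι≈× : ∀ n → ι n ≈ n × 1#
  ι≈× zero    = refl
  ι≈× (suc n) = trans (+-congˡ (ι≈× n)) (sym (1+× n 1#))

  ι-+ : ∀ m n → ι (m ℕ.+ n) ≈ ι m + ι n
  ι-+ m n = trans (ι≈× (m ℕ.+ n)) (trans (×-homo-+ 1# m n) (sym (+-cong (ι≈× m) (ι≈× n))))

  ι-* : ∀ m n → ι (m ℕ.* n) ≈ ι m * ι n
  ι-* m n = trans (ι≈× (m ℕ.* n)) (trans (×1-homo-* m n) (sym (*-cong (ι≈× m) (ι≈× n))))

  -- With the optimised _×_, 1 × 1# is 1#, so the solver constant :1 below denotes 1# itself and
  -- natR (suc n) = 1# + natR n is read by the solver without rewriting.
  ℤ→R : ℤ → Carrier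
  ℤ→R (ℤ.+ n)  = n × 1#
  ℤ→R -[1+ n ] = - (suc n × 1#)

  ℤ→R-⊖ : ∀ m n → ℤ→R (m ⊖ n) ≈ m × 1# - n × 1#
  ℤ→R-⊖ zero    zero    = sym (-‿inverseʳ 0#)
  ℤ→R-⊖ zero    (suc n) = sym (+-identityˡ _)
  ℤ→R-⊖ (suc m) zero    = sym (trans (+-congˡ -0#≈0#) (+-identityʳ _))
  ℤ→R-⊖ (suc m) (suc n) = begin
    ℤ→R (suc m ⊖ suc n)                 ≡⟨ ≡.cong ℤ→R (ℤ.[1+m]⊖[1+n]≡m⊖n m n) ⟩
    ℤ→R (m ⊖ n)                         ≈⟨ ℤ→R-⊖ m n ⟩
    m′ - n′                             ≈⟨ xyx⁻¹≈y 1# (m′ - n′) ⟨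
    1# + (m′ - n′) - 1#                 ≈⟨ +-congʳ (+-assoc 1# m′ (- n′)) ⟨
    (1# + m′) - n′ - 1#                 ≈⟨ +-assoc _ (- n′) (- 1#) ⟩
    (1# + m′) + (- n′ - 1#)             ≈⟨ +-congˡ (trans (+-comm _ _) (⁻¹-∙-comm 1# n′)) ⟩
    (1# + m′) - (1# + n′)               ≈⟨ +-cong (1+× m 1#) (-‿cong (1+× n 1#)) ⟨
    suc m × 1# - suc n × 1#             ∎
    where
    m′ n′ : Carrier
    m′ = m × 1#
    n′ = n × 1#

  ℤ→R-neg : ∀ i → ℤ→R (ℤ.- i) ≈ - ℤ→R i
  ℤ→R-neg (ℤ.+ zero)  = sym -0#≈0#
  ℤ→R-neg (ℤ.+ suc n) = refl
  ℤ→R-neg -[1+ n ]    = sym (-‿involutive _)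

  ℤ→R-+ : ∀ i j → ℤ→R (i ℤ.+ j) ≈ ℤ→R i + ℤ→R j
  ℤ→R-+ -[1+ m ] -[1+ n ] = begin
    - (suc (suc (m ℕ.+ n)) × 1#)          ≡⟨ ≡.cong (λ k → - (suc k × 1#)) (ℕ.+-suc m n) ⟨
    - ((suc m ℕ.+ suc n) × 1#)            ≈⟨ -‿cong (×-homo-+ 1# (suc m) (suc n)) ⟩
    - (suc m × 1# + suc n × 1#)           ≈⟨ ⁻¹-∙-comm _ _ ⟨
    - (suc m × 1#) - (suc n × 1#)         ∎
  ℤ→R-+ -[1+ m ] (ℤ.+ n)  = trans (ℤ→R-⊖ n (suc m)) (+-comm _ _)
  ℤ→R-+ (ℤ.+ m)  -[1+ n ] = ℤ→R-⊖ m (suc n)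
  ℤ→R-+ (ℤ.+ m)  (ℤ.+ n)  = ×-homo-+ 1# m n

  σ : Sign → Carrier
  σ Sign.+ = 1#
  σ Sign.- = - 1#

  σ-* : ∀ s t → σ (s Sign.* t) ≈ σ s * σ t
  σ-* Sign.+ t      = sym (*-identityˡ _)
  σ-* Sign.- Sign.+ = sym (*-identityʳ _)
  σ-* Sign.- Sign.- = sym (trans (-1*x≈-x (- 1#)) (-‿involutive 1#))

  ℤ→R-◃ : ∀ s n → ℤ→R (s ◃ n) ≈ σ s * n × 1#
  ℤ→R-◃ s      zero    = sym (zeroʳ _)
  ℤ→R-◃ Sign.+ (suc n) = sym (*-identityˡ _)
  ℤ→R-◃ Sign.- (suc n) = sym (-1*x≈-x _)

  ℤ→R-sign-abs : ∀ i → ℤ→R i ≈ σ (sign i) * ∣ i ∣ × 1#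
  ℤ→R-sign-abs i = trans (reflexive (≡.cong ℤ→R (≡.sym (ℤ.◃-inverse i)))) (ℤ→R-◃ (sign i) ∣ i ∣)

  ℤ→R-* : ∀ i j → ℤ→R (i ℤ.* j) ≈ ℤ→R i * ℤ→R j
  ℤ→R-* i j = begin
    ℤ→R (sign i Sign.* sign j ◃ ∣ i ∣ ℕ.* ∣ j ∣)           ≈⟨ ℤ→R-◃ _ (∣ i ∣ ℕ.* ∣ j ∣) ⟩
    σ (sign i Sign.* sign j) * (∣ i ∣ ℕ.* ∣ j ∣) × 1#      ≈⟨ *-cong (σ-* (sign i) (sign j)) (×1-homo-* ∣ i ∣ ∣ j ∣) ⟩
    (σ (sign i) * σ (sign j)) * (∣ i ∣ × 1# * ∣ j ∣ × 1#)  ≈⟨ interchange _ _ _ _ ⟩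
    (σ (sign i) * ∣ i ∣ × 1#) * (σ (sign j) * ∣ j ∣ × 1#)  ≈⟨ *-cong (ℤ→R-sign-abs i) (ℤ→R-sign-abs j) ⟨
    ℤ→R i * ℤ→R j                                          ∎

  ℤ→R-homomorphism : CommutativeRing.rawRing ℤ.+-*-commutativeRing -Raw-AlmostCommutative⟶ fromCommutativeRing R
  ℤ→R-homomorphism = record
    { ⟦_⟧    = ℤ→R
    ; +-homo = ℤ→R-+
    ; *-homo = ℤ→R-*
    ; -‿homo = ℤ→R-neg
    ; 0-homo = refl
    ; 1-homo = refl
    }

  open import Algebra.Solver.Ring (CommutativeRing.rawRing ℤ.+-*-commutativeRing) (fromCommutativeRing R) ℤ→R-homomorphism
    (λ i j → Maybe.map (λ i≡j → reflexive (≡.cong ℤ→R i≡j)) (dec⇒maybe (i ℤ.≟ j)))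

  :0 :1 : ∀ {n} → Polynomial n
  :0 = con (ℤ.+ 0)
  :1 = con (ℤ.+ 1)

  -- Sums over ranges and convolution

  -- Opaque, so that a sum over suc n is not unfolded during unification; ∑-zero and ∑-suc are
  -- its defining equations.
  opaque
    ∑< : ℕ → (ℕ → Carrier) → Carrier
    ∑< zero    f = 0#
    ∑< (suc n) f = f 0 + ∑< n (λ t → f (suc t))

    syntax ∑< n (λ t → x) = ∑[ t < n ] x

    ∑-zero : ∀ (f : ℕ → Carrier) → ∑[ t < 0 ] f t ≈ 0#
    ∑-zero f = refl

    ∑-suc : ∀ n (f : ℕ → Carrier) → ∑[ t < suc n ] f t ≈ f 0 + ∑[ t < n ] f (suc t)
    ∑-suc n f = refl

    ∑-cong-< : ∀ n {f g : ℕ → Carrier} → (∀ t → t ℕ.< n → f t ≈ g t) → ∑[ t < n ] f t ≈ ∑[ t < n ] g t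
    ∑-cong-< zero    f≈g = refl
    ∑-cong-< (suc n) f≈g = +-cong (f≈g 0 (s≤s z≤n)) (∑-cong-< n (λ t t<n → f≈g (suc t) (s≤s t<n)))

    ∑-distrib-+ : ∀ n (f g : ℕ → Carrier) → ∑[ t < n ] (f t + g t) ≈ ∑[ t < n ] f t + ∑[ t < n ] g t
    ∑-distrib-+ zero    f g = sym (+-identityˡ 0#)
    ∑-distrib-+ (suc n) f g = trans (+-congˡ (∑-distrib-+ n _ _)) (+-interchange _ _ _ _)

    ∑-*ˡ : ∀ n r (f : ℕ → Carrier) → ∑[ t < n ] (r * f t) ≈ r * ∑[ t < n ] f t
    ∑-*ˡ zero    r f = sym (zeroʳ r)
    ∑-*ˡ (suc n) r f = trans (+-congˡ (∑-*ˡ n r _)) (sym (distribˡ r _ _))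

    ∑-last : ∀ n (f : ℕ → Carrier) → ∑[ t < suc n ] f t ≈ ∑[ t < n ] f t + f n
    ∑-last zero    f = +-comm _ _
    ∑-last (suc n) f = trans (+-congˡ (∑-last n _)) (sym (+-assoc _ _ _))

  ∑-cong : ∀ n {f g : ℕ → Carrier} → (∀ t → f t ≈ g t) → ∑[ t < n ] f t ≈ ∑[ t < n ] g t
  ∑-cong n f≈g = ∑-cong-< n (λ t _ → f≈g t)

  ∑-reverse : ∀ n (f : ℕ → Carrier) → ∑[ t < n ] f t ≈ ∑[ t < n ] f (n ∸ suc t)
  ∑-reverse zero    f = trans (∑-zero f) (sym (∑-zero _))
  ∑-reverse (suc n) f = begin
    ∑[ t < suc n ] f t                  ≈⟨ ∑-last n f ⟩
    ∑[ t < n ] f t + f n                ≈⟨ +-congʳ (∑-reverse n f) ⟩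
    ∑[ t < n ] f (n ∸ suc t) + f n      ≈⟨ +-comm _ _ ⟩
    f n + ∑[ t < n ] f (n ∸ suc t)      ≈⟨ ∑-suc n (λ t → f (suc n ∸ suc t)) ⟨
    ∑[ t < suc n ] f (suc n ∸ suc t)    ∎

  ∑-telescope : ∀ n (f : ℕ → Carrier) → ∑[ t < n ] (f (suc t) - f t) ≈ f n - f 0
  ∑-telescope zero    f = trans (∑-zero _) (sym (-‿inverseʳ (f 0)))
  ∑-telescope (suc n) f = begin
    ∑[ t < suc n ] (f (suc t) - f t)                   ≈⟨ ∑-last n _ ⟩
    ∑[ t < n ] (f (suc t) - f t) + (f (suc n) - f n)   ≈⟨ +-congʳ (∑-telescope n f) ⟩
    (f n - f 0) + (f (suc n) - f n)                    ≈⟨ solve 3 (λ a b c → (b :- a) :+ (c :- b) := c :- a) refl (f 0) (f n) (f (suc n)) ⟩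
    f (suc n) - f 0                                    ∎

  infixl 7 _⋆_
  _⋆_ : (ℕ → Carrier) → (ℕ → Carrier) → ℕ → Carrier
  (u ⋆ v) m = ∑[ t < suc m ] (u (m ∸ t) * v t)

  shift : ℕ → (ℕ → Carrier) → ℕ → Carrier
  shift a f t = f (a ℕ.+ t)

  ⋆-congʳ : ∀ u {v v′ : ℕ → Carrier} m → (∀ t → v t ≈ v′ t) → (u ⋆ v) m ≈ (u ⋆ v′) m
  ⋆-congʳ u m v≈v′ = ∑-cong (suc m) (λ t → *-congˡ (v≈v′ t))

  ⋆-distrib-+ : ∀ u (v v′ : ℕ → Carrier) m → (u ⋆ (λ t → v t + v′ t)) m ≈ (u ⋆ v) m + (u ⋆ v′) m
  ⋆-distrib-+ u v v′ m = trans (∑-cong (suc m) (λ t → distribˡ (u (m ∸ t)) (v t) (v′ t))) (∑-distrib-+ (suc m) _ _)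

  ⋆-*ʳ : ∀ u r (v : ℕ → Carrier) m → (u ⋆ (λ t → r * v t)) m ≈ r * (u ⋆ v) m
  ⋆-*ʳ u r v m = trans (∑-cong (suc m) (λ t → x∙yz≈y∙xz (u (m ∸ t)) r (v t))) (∑-*ˡ (suc m) r _)

  ⋆-zero : ∀ (u v : ℕ → Carrier) → (u ⋆ v) 0 ≈ u 0 * v 0
  ⋆-zero u v = trans (∑-suc 0 _) (trans (+-congˡ (∑-zero _)) (+-identityʳ _))

  ⋆-suc : ∀ (u v : ℕ → Carrier) m → (u ⋆ v) (suc m) ≈ u (suc m) * v 0 + (u ⋆ (λ t → v (suc t))) m
  ⋆-suc u v m = ∑-suc (suc m) _

  ⋆-tail : ∀ (u v : ℕ → Carrier) m → (u ⋆ (λ t → v (suc t))) m ≈ (u ⋆ v) (suc m) - u (suc m) * v 0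
  ⋆-tail u v m = begin
    (u ⋆ (λ t → v (suc t))) m                                     ≈⟨ solve 2 (λ x y → x := (y :+ x) :- y) refl _ (u (suc m) * v 0) ⟩
    (u (suc m) * v 0 + (u ⋆ (λ t → v (suc t))) m) - u (suc m) * v 0 ≈⟨ +-congʳ (⋆-suc u v m) ⟨
    (u ⋆ v) (suc m) - u (suc m) * v 0                             ∎

  -- The closed form

  module ClosedForm (h : ℕ → Carrier) where

    nested : ℕ → ℕ → (ℕ → Carrier) → Carrier
    nested N k f = (h ⋆ (λ j → (h ⋆ shift (suc j) f) N)) k

    exchangeTerm : ℕ → ℕ → (ℕ → Carrier) → ℕ → Carrier
    exchangeTerm N k f s = h (N ∸ s) * (h ⋆ f) (suc s ℕ.+ k) - h (suc s ℕ.+ k) * (h ⋆ f) (N ∸ s)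

    nested-zero : ∀ k f → nested 0 k f ≈ exchangeTerm 0 k f 0
    nested-zero k f = begin
      nested 0 k f
        ≈⟨ ⋆-congʳ h k (λ j → trans (⋆-zero h _) (*-congˡ (reflexive (≡.cong (λ i → f (suc i)) (ℕ.+-identityʳ j))))) ⟩
      (h ⋆ (λ j → h 0 * f (suc j))) k                  ≈⟨ ⋆-*ʳ h (h 0) _ k ⟩
      h 0 * (h ⋆ (λ j → f (suc j))) k                  ≈⟨ *-congˡ (⋆-tail h f k) ⟩
      h 0 * ((h ⋆ f) (suc k) - h (suc k) * f 0)
        ≈⟨ solve 4 (λ a x y z → a :* (x :- y :* z) := a :* x :- y :* (a :* z)) refl (h 0) _ (h (suc k)) (f 0) ⟩
      h 0 * (h ⋆ f) (suc k) - h (suc k) * (h 0 * f 0)  ≈⟨ +-congˡ (-‿cong (*-congˡ (⋆-zero h f))) ⟨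
      exchangeTerm 0 k f 0                             ∎

    nested-suc : ∀ N k f → nested (suc N) k f ≈ exchangeTerm (suc N) k f 0 + nested N (suc k) f
    nested-suc N k f = begin
      nested (suc N) k f
        ≈⟨ ⋆-congʳ h k shift-step ⟩
      (h ⋆ (λ j → h (suc N) * f (suc j) + Z j)) k
        ≈⟨ trans (⋆-distrib-+ h _ Z k) (+-congʳ (⋆-*ʳ h (h (suc N)) _ k)) ⟩
      h (suc N) * (h ⋆ (λ j → f (suc j))) k + (h ⋆ Z) k
        ≈⟨ +-congʳ (*-congˡ (⋆-tail h f k)) ⟩
      h (suc N) * ((h ⋆ f) (suc k) - h (suc k) * f 0) + (h ⋆ Z) k
        ≈⟨ solve 6 (λ a b x y z w → a :* (x :- b :* z) :+ w := (a :* x :- b :* y) :+ (b :* (y :- a :* z) :+ w))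
                   refl (h (suc N)) (h (suc k)) ((h ⋆ f) (suc k)) ((h ⋆ f) (suc N)) (f 0) ((h ⋆ Z) k) ⟩
      exchangeTerm (suc N) k f 0 + (h (suc k) * ((h ⋆ f) (suc N) - h (suc N) * f 0) + (h ⋆ Z) k)
        ≈⟨ +-congˡ (+-congʳ (*-congˡ (⋆-tail h f N))) ⟨
      exchangeTerm (suc N) k f 0 + (h (suc k) * (h ⋆ (λ t → f (suc t))) N + (h ⋆ Z) k)
        ≈⟨ +-congˡ (⋆-suc h _ k) ⟨
      exchangeTerm (suc N) k f 0 + nested N (suc k) f
        ∎
      where
      Z : ℕ → Carrier
      Z j = (h ⋆ shift (suc (suc j)) f) N

      shift-step : ∀ j → (h ⋆ shift (suc j) f) (suc N) ≈ h (suc N) * f (suc j) + Z j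
      shift-step j = trans (⋆-suc h _ N)
        (+-cong (*-congˡ (reflexive (≡.cong (λ i → f (suc i)) (ℕ.+-identityʳ j))))
                (⋆-congʳ h N (λ t → reflexive (≡.cong (λ i → f (suc i)) (ℕ.+-suc j t)))))

    nested-∑ : ∀ N k f → nested N k f ≈ ∑[ s < suc N ] exchangeTerm N k f s
    nested-∑ zero    k f = trans (nested-zero k f) (sym (trans (∑-suc 0 _) (trans (+-congˡ (∑-zero _)) (+-identityʳ _))))
    nested-∑ (suc N) k f = begin
      nested (suc N) k f                                                            ≈⟨ nested-suc N k f ⟩
      exchangeTerm (suc N) k f 0 + nested N (suc k) f                               ≈⟨ +-congˡ (nested-∑ N (suc k) f) ⟩
      exchangeTerm (suc N) k f 0 + ∑[ s < suc N ] exchangeTerm N (suc k) f s        ≈⟨ +-congˡ (∑-cong (suc N) reindex) ⟩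
      exchangeTerm (suc N) k f 0 + ∑[ s < suc N ] exchangeTerm (suc N) k f (suc s)  ≈⟨ ∑-suc (suc N) _ ⟨
      ∑[ s < suc (suc N) ] exchangeTerm (suc N) k f s                               ∎
      where
      reindex : ∀ s → exchangeTerm N (suc k) f s ≈ exchangeTerm (suc N) k f (suc s)
      reindex s = reflexive (≡.cong (λ i → h (N ∸ s) * (h ⋆ f) i - h i * (h ⋆ f) (N ∸ s)) (ℕ.+-suc (suc s) k))

    -- The summand with i = t + 2 of the right-hand side for n = N + 1, with ∂_m S replaced by (h ⋆ f) m.
    closedTerm : ℕ → (ℕ → Carrier) → ℕ → ℕ → Carrier
    closedTerm N f k t = ι (suc t) * h (N ∸ suc t) * (h ⋆ f) (suc t ℕ.+ k)
                       + (ι (suc (suc t) ℕ.+ k) - ι (suc N)) * h (suc t ℕ.+ k) * (h ⋆ f) (N ∸ suc t)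

    closedForm : ℕ → (ℕ → Carrier) → ℕ → Carrier
    closedForm N f k = ∑[ t < N ] closedTerm N f k t

    closedTerm-suc : ∀ N f k t → closedTerm (suc N) f k (suc t) ≈ closedTerm N f (suc k) t + exchangeTerm N k f (suc t)
    closedTerm-suc N f k t = begin
      closedTerm (suc N) f k (suc t)
        ≈⟨ solve 7 (λ a n x y u v w → (:1 :+ (:1 :+ a)) :* y :* u :+ (x :- (:1 :+ (:1 :+ n))) :* v :* w
                                    := ((:1 :+ a) :* y :* u :+ (x :- (:1 :+ n)) :* v :* w) :+ (y :* u :- v :* w))
                   refl (ι t) (ι N) (ι (suc (suc (suc t) ℕ.+ k))) (h (N ∸ suc t)) ((h ⋆ f) (suc (suc t) ℕ.+ k))
                   (h (suc (suc t) ℕ.+ k)) ((h ⋆ f) (N ∸ suc t)) ⟩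
      (ι (suc t) * h (N ∸ suc t) * (h ⋆ f) i + (ι (suc i) - ι (suc N)) * h i * (h ⋆ f) (N ∸ suc t))
        + exchangeTerm N k f (suc t)
        ≡⟨ ≡.cong (λ j → (ι (suc t) * h (N ∸ suc t) * (h ⋆ f) j + (ι (suc j) - ι (suc N)) * h j * (h ⋆ f) (N ∸ suc t))
                          + exchangeTerm N k f (suc t)) (ℕ.+-suc (suc t) k) ⟨
      closedTerm N f (suc k) t + exchangeTerm N k f (suc t)
        ∎
      where
      i : ℕ
      i = suc (suc t) ℕ.+ k

    closedTerm-zero : ∀ N f k → closedTerm (suc N) f k 0 ≈ exchangeTerm N k f 0 + (ι (suc k) - ι N) * h (suc k) * (h ⋆ f) N
    closedTerm-zero N f k =
      solve 6 (λ k′ n x d y e → (:1 :+ :0) :* x :* d :+ ((:1 :+ (:1 :+ k′)) :- (:1 :+ (:1 :+ n))) :* y :* e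
                            := (x :* d :- y :* e) :+ ((:1 :+ k′) :- n) :* y :* e)
              refl (ι k) (ι N) (h N) ((h ⋆ f) (suc k)) (h (suc k)) ((h ⋆ f) N)

    closedForm-suc : ∀ N f k → closedForm (suc N) f k ≈ closedForm N f (suc k) + (nested N k f + (ι (suc k) - ι N) * h (suc k) * (h ⋆ f) N)
    closedForm-suc N f k = begin
      closedForm (suc N) f k
        ≈⟨ ∑-suc N _ ⟩
      closedTerm (suc N) f k 0 + ∑[ t < N ] closedTerm (suc N) f k (suc t)
        ≈⟨ +-cong (closedTerm-zero N f k) (trans (∑-cong N (closedTerm-suc N f k)) (∑-distrib-+ N _ _)) ⟩
      (exchangeTerm N k f 0 + c) + (closedForm N f (suc k) + ∑[ t < N ] exchangeTerm N k f (suc t))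
        ≈⟨ solve 4 (λ x c y z → (x :+ c) :+ (y :+ z) := y :+ ((x :+ z) :+ c)) refl _ c _ _ ⟩
      closedForm N f (suc k) + ((exchangeTerm N k f 0 + ∑[ t < N ] exchangeTerm N k f (suc t)) + c)
        ≈⟨ +-congˡ (+-congʳ (trans (nested-∑ N k f) (∑-suc N _))) ⟨
      closedForm N f (suc k) + (nested N k f + c)
        ∎
      where
      c : Carrier
      c = (ι (suc k) - ι N) * h (suc k) * (h ⋆ f) N

    -- Reversed, the second half of the sum is minus the first one shifted by one, so the sum telescopes.
    closedForm-zero : h 0 ≈ 1# → ∀ N f → closedForm N f 0 ≈ ι N * (h ⋆ f) N
    closedForm-zero h₀≈1 N f = begin
      closedForm N f 0                                   ≈⟨ ∑-cong N (λ t → reflexive (≡.cong (term t) (ℕ.+-identityʳ (suc t)))) ⟩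
      ∑[ t < N ] (U (suc t) + V t)                       ≈⟨ ∑-distrib-+ N _ V ⟩
      ∑[ t < N ] U (suc t) + ∑[ t < N ] V t              ≈⟨ +-congˡ (trans (∑-reverse N V) (∑-cong-< N V-reflect)) ⟩
      ∑[ t < N ] U (suc t) + ∑[ t < N ] (- U t)          ≈⟨ ∑-distrib-+ N _ _ ⟨
      ∑[ t < N ] (U (suc t) - U t)                       ≈⟨ ∑-telescope N U ⟩
      U N - U 0
        ≈⟨ +-cong (*-congʳ (trans (*-congˡ (trans (reflexive (≡.cong h (ℕ.n∸n≡0 N))) h₀≈1)) (*-identityʳ _)))
                  (trans (-‿cong (trans (*-congʳ (zeroˡ _)) (zeroˡ _))) -0#≈0#) ⟩
      ι N * (h ⋆ f) N + 0#                               ≈⟨ +-identityʳ _ ⟩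
      ι N * (h ⋆ f) N                                    ∎
      where
      U : ℕ → Carrier
      U s = ι s * h (N ∸ s) * (h ⋆ f) s

      V : ℕ → Carrier
      V t = (ι (suc (suc t)) - ι (suc N)) * h (suc t) * (h ⋆ f) (N ∸ suc t)

      term : ℕ → ℕ → Carrier
      term t i = ι (suc t) * h (N ∸ suc t) * (h ⋆ f) i + (ι (suc i) - ι (suc N)) * h i * (h ⋆ f) (N ∸ suc t)

      V-reflect : ∀ t → t ℕ.< N → V (N ∸ suc t) ≈ - U t
      V-reflect t t<N = begin
        V (N ∸ suc t)
          ≡⟨ ≡.cong (λ i → (ι (suc i) - ι (suc N)) * h i * (h ⋆ f) (N ∸ i)) (ℕ.+-∸-assoc 1 t<N) ⟨
        (ι (suc (N ∸ t)) - ι (suc N)) * h (N ∸ t) * (h ⋆ f) (N ∸ (N ∸ t))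
          ≡⟨ ≡.cong₂ (λ i j → (ι (suc (N ∸ t)) - ι (suc i)) * h (N ∸ t) * (h ⋆ f) j)
                     (≡.sym (ℕ.m∸n+n≡m t≤N)) (ℕ.m∸[m∸n]≡n t≤N) ⟩
        (ι (suc (N ∸ t)) - ι (suc (N ∸ t) ℕ.+ t)) * h (N ∸ t) * (h ⋆ f) t
          ≈⟨ *-congʳ (*-congʳ (+-congˡ (-‿cong (ι-+ (suc (N ∸ t)) t)))) ⟩
        (ι (suc (N ∸ t)) - (ι (suc (N ∸ t)) + ι t)) * h (N ∸ t) * (h ⋆ f) t
          ≈⟨ solve 4 (λ a b x y → (a :- (a :+ b)) :* x :* y := :- (b :* x :* y)) refl _ (ι t) _ _ ⟩
        - U t
          ∎
        where
        t≤N : t ≤ N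
        t≤N = ℕ.<⇒≤ t<N

  -- Linear functionals on formal sums

  sumR-map-cong : ∀ {a} {A : Set a} {φ ψ : A → Carrier} xs → (∀ x → φ x ≈ ψ x) → sumR R (map φ xs) ≈ sumR R (map ψ xs)
  sumR-map-cong []       φ≈ψ = refl
  sumR-map-cong (x ∷ xs) φ≈ψ = +-cong (φ≈ψ x) (sumR-map-cong xs φ≈ψ)

  sumR-map-+ : ∀ {a} {A : Set a} (φ ψ : A → Carrier) xs → sumR R (map (λ x → φ x + ψ x) xs) ≈ sumR R (map φ xs) + sumR R (map ψ xs)
  sumR-map-+ φ ψ []       = sym (+-identityˡ 0#)
  sumR-map-+ φ ψ (x ∷ xs) = trans (+-congˡ (sumR-map-+ φ ψ xs)) (+-interchange _ _ _ _)

  sumR-map-*ˡ : ∀ {a} {A : Set a} r (φ : A → Carrier) xs → sumR R (map (λ x → r * φ x) xs) ≈ r * sumR R (map φ xs)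
  sumR-map-*ˡ r φ []       = sym (zeroʳ r)
  sumR-map-*ˡ r φ (x ∷ xs) = trans (+-congˡ (sumR-map-*ˡ r φ xs)) (sym (distribˡ r _ _))

  sumR-map-applyUpTo : ∀ (f : ℕ → Carrier) q n → sumR R (map f (applyUpTo q n)) ≈ ∑[ t < n ] f (q t)
  sumR-map-applyUpTo f q zero    = sym (∑-zero _)
  sumR-map-applyUpTo f q (suc n) = trans (+-congˡ (sumR-map-applyUpTo f (λ t → q (suc t)) n)) (sym (∑-suc n _))

  δ : Crossing → Crossing → Carrier
  δ d e with ≡-dec ℕ._≟_ d e
  ... | yes _ = 1#
  ... | no  _ = 0#

  extend : (Crossing → Carrier) → Mod R → Carrier
  extend φ []            = 0#
  extend φ ((r , e) ∷ u) = r * φ e + extend φ u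

  coeff≈extend-δ : ∀ d u → coeff R d u ≈ extend (δ d) u
  coeff≈extend-δ d []            = refl
  coeff≈extend-δ d ((r , e) ∷ u) with ≡-dec ℕ._≟_ d e
  ... | yes _ = +-cong (sym (*-identityʳ r)) (coeff≈extend-δ d u)
  ... | no  _ = trans (coeff≈extend-δ d u) (sym (trans (+-congʳ (zeroʳ r)) (+-identityˡ _)))

  extend-++ : ∀ φ (u v : Mod R) → extend φ (u ++ v) ≈ extend φ u + extend φ v
  extend-++ φ []            v = sym (+-identityˡ _)
  extend-++ φ ((r , e) ∷ u) v = trans (+-congˡ (extend-++ φ u v)) (sym (+-assoc _ _ _))

  extend-scale : ∀ φ r (u : Mod R) → extend φ (scale R r u) ≈ r * extend φ u
  extend-scale φ r []            = sym (zeroʳ r)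
  extend-scale φ r ((s , e) ∷ u) = trans (+-cong (*-assoc r s (φ e)) (extend-scale φ r u)) (sym (distribˡ r _ _))

  extend-units : ∀ φ (es : List Crossing) → extend φ (map (λ e → (1# , e)) es) ≈ sumR R (map φ es)
  extend-units φ []       = refl
  extend-units φ (e ∷ es) = +-cong (*-identityˡ (φ e)) (extend-units φ es)

  extend-applyUpTo : ∀ φ (r : ℕ → Carrier) (e : ℕ → Crossing) q n →
                     extend φ (map (λ j → (r j , e j)) (applyUpTo q n)) ≈ ∑[ t < n ] (r (q t) * φ (e (q t)))
  extend-applyUpTo φ r e q zero    = sym (∑-zero _)
  extend-applyUpTo φ r e q (suc n) = trans (+-congˡ (extend-applyUpTo φ r e (λ t → q (suc t)) n)) (sym (∑-suc n _))

  extend-concatMap-applyUpTo : ∀ φ (g : ℕ → Mod R) q n → extend φ (concatMap g (applyUpTo q n)) ≈ ∑[ t < n ] extend φ (g (q t))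
  extend-concatMap-applyUpTo φ g q zero    = sym (∑-zero _)
  extend-concatMap-applyUpTo φ g q (suc n) = begin
    extend φ (g (q 0) ++ concatMap g (applyUpTo (λ t → q (suc t)) n))   ≈⟨ extend-++ φ (g (q 0)) _ ⟩
    extend φ (g (q 0)) + extend φ (concatMap g (applyUpTo (λ t → q (suc t)) n))
      ≈⟨ +-congˡ (extend-concatMap-applyUpTo φ g (λ t → q (suc t)) n) ⟩
    extend φ (g (q 0)) + ∑[ t < n ] extend φ (g (q (suc t)))            ≈⟨ ∑-suc n _ ⟨
    ∑[ t < suc n ] extend φ (g (q t))                                   ∎

  extend-tr : ∀ p φ (u : Mod R) → extend φ (tr R p u) ≈ extend (λ e → extend φ (trBasis R p e)) u
  extend-tr p φ []            = refl
  extend-tr p φ ((r , e) ∷ u) = trans (extend-++ φ (scale R r (trBasis R p e)) (tr R p u))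
                                      (+-cong (extend-scale φ r (trBasis R p e)) (extend-tr p φ u))

  trIter-suc : ∀ p m (u : Mod R) → trIter R p (suc m) u ≡ trIter R p m (tr R p u)
  trIter-suc p zero    u = ≡.refl
  trIter-suc p (suc m) u = ≡.cong (tr R p) (trIter-suc p m u)

  -- Adding dots to one strand

  dotSum : (Crossing → Carrier) → ℕ → Crossing → Carrier
  dotSum φ a xs = sumR R (map φ (addEach R a xs))

  dotSum-∷ : ∀ φ a y ys → dotSum φ a (y ∷ ys) ≡ φ (y ℕ.+ a ∷ ys) + dotSum (λ e → φ (y ∷ e)) a ys
  dotSum-∷ φ a y ys = ≡.cong (λ l → φ (y ℕ.+ a ∷ ys) + sumR R l) (≡.sym (map-∘ (addEach R a ys)))

  dotSum-cong-length : ∀ {φ ψ} a xs → (∀ e → length e ≡ length xs → φ e ≈ ψ e) → dotSum φ a xs ≈ dotSum ψ a xs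
  dotSum-cong-length a []       φ≈ψ = refl
  dotSum-cong-length {φ} {ψ} a (y ∷ ys) φ≈ψ = begin
    dotSum φ a (y ∷ ys)
      ≡⟨ dotSum-∷ φ a y ys ⟩
    φ (y ℕ.+ a ∷ ys) + dotSum (λ e → φ (y ∷ e)) a ys
      ≈⟨ +-cong (φ≈ψ _ ≡.refl) (dotSum-cong-length a ys (λ e ∣e∣ → φ≈ψ (y ∷ e) (≡.cong suc ∣e∣))) ⟩
    ψ (y ℕ.+ a ∷ ys) + dotSum (λ e → ψ (y ∷ e)) a ys
      ≡⟨ dotSum-∷ ψ a y ys ⟨
    dotSum ψ a (y ∷ ys)
      ∎

  dotSum-++ : ∀ φ a xs ys → dotSum φ a (xs ++ ys) ≈ dotSum (λ e → φ (e ++ ys)) a xs + dotSum (λ e → φ (xs ++ e)) a ys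
  dotSum-++ φ a []       ys = sym (+-identityˡ _)
  dotSum-++ φ a (x ∷ xs) ys = begin
    dotSum φ a (x ∷ xs ++ ys)                                               ≡⟨ dotSum-∷ φ a x (xs ++ ys) ⟩
    φ (x ℕ.+ a ∷ xs ++ ys) + dotSum (λ e → φ (x ∷ e)) a (xs ++ ys)         ≈⟨ +-congˡ (dotSum-++ (λ e → φ (x ∷ e)) a xs ys) ⟩
    φ (x ℕ.+ a ∷ xs ++ ys) + (dotSum (λ e → φ (x ∷ e ++ ys)) a xs + dotSum (λ e → φ (x ∷ xs ++ e)) a ys)
      ≈⟨ +-assoc _ _ _ ⟨
    (φ (x ℕ.+ a ∷ xs ++ ys) + dotSum (λ e → φ (x ∷ e ++ ys)) a xs) + dotSum (λ e → φ (x ∷ xs ++ e)) a ys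
      ≡⟨ ≡.cong (_+ dotSum (λ e → φ (x ∷ xs ++ e)) a ys) (dotSum-∷ (λ e → φ (e ++ ys)) a x xs) ⟨
    dotSum (λ e → φ (e ++ ys)) a (x ∷ xs) + dotSum (λ e → φ (x ∷ xs ++ e)) a ys ∎

  dotSum-dotSum-∷ : ∀ φ b c y ys → dotSum (dotSum φ b) c (y ∷ ys) ≈
    φ (y ℕ.+ c ℕ.+ b ∷ ys) + (dotSum (λ e → φ (y ℕ.+ c ∷ e)) b ys + dotSum (λ e → φ (y ℕ.+ b ∷ e)) c ys)
      + dotSum (dotSum (λ e → φ (y ∷ e)) b) c ys
  dotSum-dotSum-∷ φ b c y ys = begin
    dotSum (dotSum φ b) c (y ∷ ys)
      ≡⟨ dotSum-∷ (dotSum φ b) c y ys ⟩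
    dotSum φ b (y ℕ.+ c ∷ ys) + dotSum (λ e → dotSum φ b (y ∷ e)) c ys
      ≡⟨ ≡.cong₂ _+_ (dotSum-∷ φ b (y ℕ.+ c) ys) (≡.cong (sumR R) (map-cong (dotSum-∷ φ b y) (addEach R c ys))) ⟩
    (x + A) + dotSum (λ e → φ (y ℕ.+ b ∷ e) + dotSum (λ e′ → φ (y ∷ e′)) b e) c ys
      ≈⟨ +-congˡ (sumR-map-+ _ _ (addEach R c ys)) ⟩
    (x + A) + (B + C)
      ≈⟨ solve 4 (λ x a b c → (x :+ a) :+ (b :+ c) := (x :+ (a :+ b)) :+ c) refl x A B C ⟩
    x + (A + B) + C
      ∎
    where
    x A B C : Carrier
    x = φ (y ℕ.+ c ℕ.+ b ∷ ys)
    A = dotSum (λ e → φ (y ℕ.+ c ∷ e)) b ys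
    B = dotSum (λ e → φ (y ℕ.+ b ∷ e)) c ys
    C = dotSum (dotSum (λ e → φ (y ∷ e)) b) c ys

  dotSum-comm : ∀ φ b c xs → dotSum (dotSum φ b) c xs ≈ dotSum (dotSum φ c) b xs
  dotSum-comm φ b c []       = refl
  dotSum-comm φ b c (y ∷ ys) = begin
    dotSum (dotSum φ b) c (y ∷ ys)
      ≈⟨ dotSum-dotSum-∷ φ b c y ys ⟩
    φ (y ℕ.+ c ℕ.+ b ∷ ys) + (dotSum (λ e → φ (y ℕ.+ c ∷ e)) b ys + dotSum (λ e → φ (y ℕ.+ b ∷ e)) c ys)
      + dotSum (dotSum (λ e → φ (y ∷ e)) b) c ys
      ≈⟨ +-cong (+-cong (reflexive (≡.cong (λ i → φ (i ∷ ys)) y+c+b≡y+b+c)) (+-comm _ _))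
                (dotSum-comm (λ e → φ (y ∷ e)) b c ys) ⟩
    φ (y ℕ.+ b ℕ.+ c ∷ ys) + (dotSum (λ e → φ (y ℕ.+ b ∷ e)) c ys + dotSum (λ e → φ (y ℕ.+ c ∷ e)) b ys)
      + dotSum (dotSum (λ e → φ (y ∷ e)) c) b ys
      ≈⟨ dotSum-dotSum-∷ φ c b y ys ⟨
    dotSum (dotSum φ c) b (y ∷ ys) ∎
    where
    y+c+b≡y+b+c : y ℕ.+ c ℕ.+ b ≡ y ℕ.+ b ℕ.+ c
    y+c+b≡y+b+c = ≡.trans (ℕ.+-assoc y c b) (≡.trans (≡.cong (y ℕ.+_) (ℕ.+-comm c b)) (≡.sym (ℕ.+-assoc y b c)))

  SwapInvariant : (Crossing → Carrier) → ℕ → Set ℓ₂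
  SwapInvariant φ k = ∀ xs b c ys → length ys ≡ k → φ (xs ++ b ∷ c ∷ ys) ≈ φ (xs ++ c ∷ b ∷ ys)

  dotSum-swapInvariant : ∀ {φ k} a → SwapInvariant φ k → SwapInvariant (dotSum φ a) k
  dotSum-swapInvariant {φ} a inv xs b c ys ∣ys∣ = begin
    dotSum φ a (xs ++ b ∷ c ∷ ys)                             ≈⟨ dotSum-++ φ a xs (b ∷ c ∷ ys) ⟩
    L b c + dotSum (λ e → φ (xs ++ e)) a (b ∷ c ∷ ys)         ≡⟨ ≡.cong (L b c +_) (split b c) ⟩
    L b c + (F (b ℕ.+ a) c + (F b (c ℕ.+ a) + M b c))
      ≈⟨ +-cong (sumR-map-cong (addEach R a xs) (λ e → inv e b c ys ∣ys∣))
                (+-cong (inv xs (b ℕ.+ a) c ys ∣ys∣)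
                        (+-cong (inv xs b (c ℕ.+ a) ys ∣ys∣)
                                (dotSum-cong-length a ys (λ e ∣e∣ → inv xs b c e (≡.trans ∣e∣ ∣ys∣))))) ⟩
    L c b + (F c (b ℕ.+ a) + (F (c ℕ.+ a) b + M c b))         ≈⟨ +-congˡ (x+[y+z]≈y+[x+z] _ _ _) ⟩
    L c b + (F (c ℕ.+ a) b + (F c (b ℕ.+ a) + M c b))         ≡⟨ ≡.cong (L c b +_) (split c b) ⟨
    L c b + dotSum (λ e → φ (xs ++ e)) a (c ∷ b ∷ ys)         ≈⟨ dotSum-++ φ a xs (c ∷ b ∷ ys) ⟨
    dotSum φ a (xs ++ c ∷ b ∷ ys)                             ∎
    where
    F : ℕ → ℕ → Carrier
    F b c = φ (xs ++ b ∷ c ∷ ys)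

    L M : ℕ → ℕ → Carrier
    L b c = dotSum (λ e → φ (e ++ b ∷ c ∷ ys)) a xs
    M b c = dotSum (λ e → φ (xs ++ b ∷ c ∷ e)) a ys

    split : ∀ b c → dotSum (λ e → φ (xs ++ e)) a (b ∷ c ∷ ys) ≡ F (b ℕ.+ a) c + (F b (c ℕ.+ a) + M b c)
    split b c = ≡.trans (dotSum-∷ _ a b (c ∷ ys)) (≡.cong (F (b ℕ.+ a) c +_) (dotSum-∷ _ a c ys))

  -- Full traces

  trBasis-∷ʳ : ∀ p xs a → trBasis R p (xs ∷ʳ a) ≡ (p (suc a) , xs) ∷ map (λ e → (1# , e)) (addEach R (suc a) xs)
  trBasis-∷ʳ p xs a rewrite unsnoc-∷ʳ xs a = ≡.refl

  module Trace (p : ℕ → Carrier) (d : Crossing) where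

    trCoeff : ℕ → Crossing → Carrier
    trCoeff zero    e = δ d e
    trCoeff (suc m) e = extend (trCoeff m) (trBasis R p e)

    coeff-trIter : ∀ m u → coeff R d (trIter R p m u) ≈ extend (trCoeff m) u
    coeff-trIter zero    u = coeff≈extend-δ d u
    coeff-trIter (suc m) u = begin
      coeff R d (trIter R p (suc m) u)      ≡⟨ ≡.cong (coeff R d) (trIter-suc p m u) ⟩
      coeff R d (trIter R p m (tr R p u))   ≈⟨ coeff-trIter m (tr R p u) ⟩
      extend (trCoeff m) (tr R p u)         ≈⟨ extend-tr p (trCoeff m) u ⟩
      extend (trCoeff (suc m)) u            ∎

    trCoeff-∷ʳ : ∀ m xs a → trCoeff (suc m) (xs ∷ʳ a) ≈ p (suc a) * trCoeff m xs + dotSum (trCoeff m) (suc a) xs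
    trCoeff-∷ʳ m xs a rewrite trBasis-∷ʳ p xs a = +-congˡ (extend-units (trCoeff m) (addEach R (suc a) xs))

    trCoeff-swap-last : ∀ m → SwapInvariant (trCoeff (suc (suc m))) 0
    trCoeff-swap-last m xs b c [] ≡.refl = begin
      trCoeff (suc (suc m)) (xs ++ b ∷ c ∷ [])
        ≈⟨ expand b c ⟩
      p (suc c) * Q b + ((p (suc b) * S c + SS b c) + Q (b ℕ.+ suc c))
        ≈⟨ +-congˡ (+-cong (+-congˡ (dotSum-comm T (suc b) (suc c) xs)) (reflexive (≡.cong Q b+1+c≡c+1+b))) ⟩
      p (suc c) * Q b + ((p (suc b) * S c + SS c b) + Q (c ℕ.+ suc b))
        ≈⟨ solve 7 (λ x y t u v z q → x :* (y :* t :+ u) :+ ((y :* v :+ z) :+ q) := y :* (x :* t :+ v) :+ ((x :* u :+ z) :+ q))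
                   refl (p (suc c)) (p (suc b)) (T xs) (S b) (S c) (SS c b) (Q (c ℕ.+ suc b)) ⟩
      p (suc b) * Q c + ((p (suc c) * S b + SS c b) + Q (c ℕ.+ suc b))
        ≈⟨ expand c b ⟨
      trCoeff (suc (suc m)) (xs ++ c ∷ b ∷ [])
        ∎
      where
      T : Crossing → Carrier
      T = trCoeff m

      S : ℕ → Carrier
      S i = dotSum T (suc i) xs

      SS : ℕ → ℕ → Carrier
      SS b c = dotSum (dotSum T (suc b)) (suc c) xs

      Q : ℕ → Carrier
      Q i = p (suc i) * T xs + S i

      b+1+c≡c+1+b : b ℕ.+ suc c ≡ c ℕ.+ suc b
      b+1+c≡c+1+b = ≡.trans (ℕ.+-suc b c) (≡.trans (≡.cong suc (ℕ.+-comm b c)) (≡.sym (ℕ.+-suc c b)))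

      expand : ∀ b c → trCoeff (suc (suc m)) (xs ++ b ∷ c ∷ []) ≈ p (suc c) * Q b + ((p (suc b) * S c + SS b c) + Q (b ℕ.+ suc c))
      expand b c = begin
        trCoeff (suc (suc m)) (xs ++ b ∷ c ∷ [])
          ≡⟨ ≡.cong (trCoeff (suc (suc m))) (∷ʳ-++ xs b (c ∷ [])) ⟨
        trCoeff (suc (suc m)) ((xs ∷ʳ b) ∷ʳ c)
          ≈⟨ trCoeff-∷ʳ (suc m) (xs ∷ʳ b) c ⟩
        p (suc c) * trCoeff (suc m) (xs ∷ʳ b) + dotSum (trCoeff (suc m)) (suc c) (xs ∷ʳ b)
          ≈⟨ +-cong (*-congˡ (trCoeff-∷ʳ m xs b)) (dotSum-++ (trCoeff (suc m)) (suc c) xs (b ∷ [])) ⟩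
        p (suc c) * Q b + (dotSum (λ e → trCoeff (suc m) (e ∷ʳ b)) (suc c) xs + (trCoeff (suc m) (xs ∷ʳ (b ℕ.+ suc c)) + 0#))
          ≈⟨ +-congˡ (+-cong (trans (sumR-map-cong (addEach R (suc c) xs) (λ e → trCoeff-∷ʳ m e b))
                                    (trans (sumR-map-+ _ _ (addEach R (suc c) xs)) (+-congʳ (sumR-map-*ˡ (p (suc b)) T (addEach R (suc c) xs)))))
                             (trans (+-identityʳ _) (trCoeff-∷ʳ m xs (b ℕ.+ suc c)))) ⟩
        p (suc c) * Q b + ((p (suc b) * S c + SS b c) + Q (b ℕ.+ suc c))
          ∎

    trCoeff-suc-swapInvariant : ∀ {m k} → SwapInvariant (trCoeff m) k → SwapInvariant (trCoeff (suc m)) (suc k)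
    trCoeff-suc-swapInvariant inv xs b c ys ∣ys∣ with initLast ys
    trCoeff-suc-swapInvariant inv xs b c .[] () | []
    trCoeff-suc-swapInvariant {m} inv xs b c .(zs ∷ʳ a) ∣ys∣ | zs ∷ʳ′ a =
      trans (expand b c) (trans (+-cong (*-congˡ (inv xs b c zs ∣zs∣)) (dotSum-swapInvariant (suc a) inv xs b c zs ∣zs∣)) (sym (expand c b)))
      where
      ∣zs∣ : length zs ≡ _
      ∣zs∣ = ℕ.suc-injective (≡.trans (≡.sym (length-∷ʳ zs a)) ∣ys∣)

      expand : ∀ b c → trCoeff (suc m) (xs ++ b ∷ c ∷ zs ∷ʳ a)
                     ≈ p (suc a) * trCoeff m (xs ++ b ∷ c ∷ zs) + dotSum (trCoeff m) (suc a) (xs ++ b ∷ c ∷ zs)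
      expand b c = trans (reflexive (≡.cong (trCoeff (suc m)) (≡.sym (++-assoc xs (b ∷ c ∷ zs) (a ∷ []))))) (trCoeff-∷ʳ m _ a)

    trCoeff-swapInvariant : ∀ {m k} → 2 ℕ.+ k ≤ m → SwapInvariant (trCoeff m) k
    trCoeff-swapInvariant {suc (suc m)} {zero}  (s≤s (s≤s _)) = trCoeff-swap-last m
    trCoeff-swapInvariant {suc m}       {suc k} (s≤s le)        = trCoeff-suc-swapInvariant {m} (trCoeff-swapInvariant {m} le)

    trCoeff-moveLast : ∀ {m} xs b ys → suc (length ys) ≤ m → trCoeff m (xs ++ b ∷ ys) ≈ trCoeff m (xs ++ ys ∷ʳ b)
    trCoeff-moveLast     xs b []       _  = refl
    trCoeff-moveLast {m} xs b (y ∷ ys) le = begin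
      trCoeff m (xs ++ b ∷ y ∷ ys)          ≈⟨ trCoeff-swapInvariant le xs b y ys ≡.refl ⟩
      trCoeff m (xs ++ y ∷ b ∷ ys)          ≡⟨ ≡.cong (trCoeff m) (∷ʳ-++ xs y (b ∷ ys)) ⟨
      trCoeff m ((xs ∷ʳ y) ++ b ∷ ys)       ≈⟨ trCoeff-moveLast (xs ∷ʳ y) b ys (ℕ.<⇒≤ le) ⟩
      trCoeff m ((xs ∷ʳ y) ++ ys ∷ʳ b)      ≡⟨ ≡.cong (trCoeff m) (∷ʳ-++ xs y (ys ∷ʳ b)) ⟩
      trCoeff m (xs ++ (y ∷ ys) ∷ʳ b)       ∎

    dotSum-zeros : ∀ {m} xs β l → suc l ≤ m →
                   dotSum (λ e → trCoeff m (xs ++ e)) β (zeros (suc l)) ≈ ι (suc l) * trCoeff m (xs ++ zeros l ∷ʳ β)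
    dotSum-zeros xs β zero    _ = trans (+-identityʳ _) (sym (trans (*-congʳ (+-identityʳ 1#)) (*-identityˡ _)))
    dotSum-zeros {m} xs β (suc l) le = begin
      dotSum (λ e → trCoeff m (xs ++ e)) β (zeros (suc (suc l)))
        ≡⟨ dotSum-∷ (λ e → trCoeff m (xs ++ e)) β 0 (zeros (suc l)) ⟩
      trCoeff m (xs ++ β ∷ zeros (suc l)) + dotSum (λ e → trCoeff m (xs ++ 0 ∷ e)) β (zeros (suc l))
        ≈⟨ +-cong (trCoeff-moveLast xs β (zeros (suc l)) (≡.subst (λ n → suc n ≤ m) (≡.sym (length-replicate (suc l))) le))
                  (sumR-map-cong (addEach R β (zeros (suc l))) (λ e → reflexive (≡.cong (trCoeff m) (≡.sym (∷ʳ-++ xs 0 e))))) ⟩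
      X + dotSum (λ e → trCoeff m ((xs ∷ʳ 0) ++ e)) β (zeros (suc l))
        ≈⟨ +-congˡ (dotSum-zeros (xs ∷ʳ 0) β l (ℕ.<⇒≤ le)) ⟩
      X + ι (suc l) * trCoeff m ((xs ∷ʳ 0) ++ zeros l ∷ʳ β)
        ≡⟨ ≡.cong (λ e → X + ι (suc l) * trCoeff m e) (∷ʳ-++ xs 0 (zeros l ∷ʳ β)) ⟩
      X + ι (suc l) * X
        ≈⟨ solve 2 (λ x n → x :+ n :* x := (:1 :+ n) :* x) refl X (ι (suc l)) ⟩
      ι (suc (suc l)) * X ∎
      where
      X : Carrier
      X = trCoeff m (xs ++ zeros (suc l) ∷ʳ β)

    trFirst : ℕ → ℕ → Carrier
    trFirst m a = trCoeff m (a ∷ zeros m)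

    trFirstLast : ℕ → ℕ → ℕ → Carrier
    trFirstLast m a b = trCoeff (suc m) (a ∷ (zeros m ∷ʳ b))

    trFirstLast-recurrence : ∀ m a b → trFirstLast m a b ≈
      p (suc b) * trFirst m a + (trFirst m (a ℕ.+ suc b) + dotSum (λ e → trCoeff m (a ∷ e)) (suc b) (zeros m))
    trFirstLast-recurrence m a b = trans (trCoeff-∷ʳ m (a ∷ zeros m) b) (+-congˡ (reflexive (dotSum-∷ (trCoeff m) (suc b) a (zeros m))))

    trFirstLast-zero : ∀ n a → trFirstLast n a 0 ≡ trFirst (suc n) a
    trFirstLast-zero n a = ≡.cong (λ l → trCoeff (suc n) (a ∷ l)) (zeros-∷ʳ n)

    module Evaluation (h : ℕ → Carrier) (h₀≈1 : h 0 ≈ 1#) (newton : Newton R h p) where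
      open ClosedForm h

      w : ℕ → Carrier
      w x = δ d (x ∷ [])

      newton-⋆ : ∀ k → (h ⋆ (λ j → p (suc j))) k ≈ ι (suc k) * h (suc k)
      newton-⋆ k = begin
        (h ⋆ (λ j → p (suc j))) k                        ≈⟨ ∑-cong (suc k) (λ t → *-comm (h (k ∸ t)) (p (suc t))) ⟩
        ∑[ t < suc k ] (p (suc t) * h (k ∸ t))
          ≈⟨ sumR-map-applyUpTo (λ t → p (suc t) * h (suc k ∸ suc t)) (λ t → t) (suc k) ⟨
        sumR R (map (λ t → p (suc t) * h (suc k ∸ suc t)) (applyUpTo (λ t → t) (suc k))) ≈⟨ newton (suc k) ⟨
        ι (suc k) * h (suc k)                             ∎

      h⋆-zero : ∀ g → (h ⋆ g) 0 ≈ g 0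
      h⋆-zero g = trans (⋆-zero h g) (trans (*-congʳ h₀≈1) (*-identityˡ (g 0)))

      mutual
        trFirst-closed : ∀ m a → trFirst m a ≈ ι (m !) * (h ⋆ shift a w) m
        trFirst-closed zero    a = sym (begin
          ι 1 * (h ⋆ shift a w) 0     ≈⟨ trans (*-congʳ (+-identityʳ 1#)) (*-identityˡ _) ⟩
          (h ⋆ shift a w) 0           ≈⟨ h⋆-zero (shift a w) ⟩
          w (a ℕ.+ 0)                 ≡⟨ ≡.cong w (ℕ.+-identityʳ a) ⟩
          w a                         ∎)
        trFirst-closed (suc n) a = begin
          trFirst (suc n) a                                           ≡⟨ trFirstLast-zero n a ⟨
          trFirstLast n a 0                                           ≈⟨ h⋆-zero (trFirstLast n a) ⟨
          (h ⋆ trFirstLast n a) 0                                     ≈⟨ trFirstLast-closed n a 0 ⟩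
          ι (n !) * closedForm (suc n) (shift a w) 0                  ≈⟨ *-congˡ (closedForm-zero h₀≈1 (suc n) (shift a w)) ⟩
          ι (n !) * (ι (suc n) * (h ⋆ shift a w) (suc n))             ≈⟨ x∙yz≈yx∙z _ _ _ ⟩
          (ι (suc n) * ι (n !)) * (h ⋆ shift a w) (suc n)             ≈⟨ *-congʳ (ι-* (suc n) (n !)) ⟨
          ι (suc n !) * (h ⋆ shift a w) (suc n)                       ∎

        trFirstLast-closed : ∀ m a k → (h ⋆ trFirstLast m a) k ≈ ι (m !) * closedForm (suc m) (shift a w) k
        trFirstLast-closed m a k = begin
          (h ⋆ trFirstLast m a) k
            ≈⟨ ⋆-congʳ h k (trFirstLast-recurrence m a) ⟩
          (h ⋆ (λ j → p (suc j) * G + (trFirst m (a ℕ.+ suc j) + Y j))) k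
            ≈⟨ trans (⋆-distrib-+ h _ _ k) (+-congˡ (⋆-distrib-+ h _ Y k)) ⟩
          (h ⋆ (λ j → p (suc j) * G)) k + ((h ⋆ (λ j → trFirst m (a ℕ.+ suc j))) k + (h ⋆ Y) k)
            ≈⟨ +-cong first-strand (+-cong shifted (⋆-dotSum-zeros m a k)) ⟩
          G * (ι (suc k) * h (suc k)) + (c * nested m k v + (c * closedForm m v (suc k) - ι m * h (suc k) * G))
            ≈⟨ +-cong (*-congʳ G-closed) (+-congˡ (+-congˡ (-‿cong (*-congˡ G-closed)))) ⟩
          (c * D) * (ι (suc k) * h (suc k)) + (c * nested m k v + (c * closedForm m v (suc k) - ι m * h (suc k) * (c * D)))
            ≈⟨ solve 7 (λ c d n x y z u → (c :* d) :* ((:1 :+ n) :* x) :+ (c :* y :+ (c :* z :- u :* x :* (c :* d)))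
                                        := c :* (z :+ (y :+ ((:1 :+ n) :- u) :* x :* d)))
                       refl c D (ι k) (h (suc k)) (nested m k v) (closedForm m v (suc k)) (ι m) ⟩
          c * (closedForm m v (suc k) + (nested m k v + (ι (suc k) - ι m) * h (suc k) * D))
            ≈⟨ *-congˡ (closedForm-suc m v k) ⟨
          c * closedForm (suc m) v k
            ∎
          where
          c : Carrier
          c = ι (m !)

          v : ℕ → Carrier
          v = shift a w

          D : Carrier
          D = (h ⋆ v) m

          G : Carrier
          G = trFirst m a

          G-closed : G ≈ c * D
          G-closed = trFirst-closed m a

          Y : ℕ → Carrier
          Y j = dotSum (λ e → trCoeff m (a ∷ e)) (suc j) (zeros m)

          first-strand : (h ⋆ (λ j → p (suc j) * G)) k ≈ G * (ι (suc k) * h (suc k))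
          first-strand = trans (⋆-congʳ h k (λ j → *-comm (p (suc j)) G)) (trans (⋆-*ʳ h G _ k) (*-congˡ (newton-⋆ k)))

          shifted : (h ⋆ (λ j → trFirst m (a ℕ.+ suc j))) k ≈ c * nested m k v
          shifted = trans (⋆-congʳ h k (λ j → trans (trFirst-closed m (a ℕ.+ suc j))
                                                    (*-congˡ (⋆-congʳ h m (λ t → reflexive (≡.cong w (ℕ.+-assoc a (suc j) t)))))))
                          (⋆-*ʳ h c _ k)

        ⋆-dotSum-zeros : ∀ m a k → (h ⋆ (λ j → dotSum (λ e → trCoeff m (a ∷ e)) (suc j) (zeros m))) k
                                   ≈ ι (m !) * closedForm m (shift a w) (suc k) - ι m * h (suc k) * trFirst m a
        ⋆-dotSum-zeros zero    a k = begin
          (h ⋆ (λ _ → 0#)) k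
            ≈⟨ ⋆-congʳ h k (λ _ → sym (zeroˡ 0#)) ⟩
          (h ⋆ (λ _ → 0# * 0#)) k
            ≈⟨ trans (⋆-*ʳ h 0# _ k) (zeroˡ _) ⟩
          0#
            ≈⟨ solve 2 (λ y z → :0 := (:1 :+ :0) :* :0 :- :0 :* y :* z) refl (h (suc k)) (trFirst 0 a) ⟩
          ι 1 * 0# - ι 0 * h (suc k) * trFirst 0 a
            ≈⟨ +-congʳ (*-congˡ (∑-zero _)) ⟨
          ι 1 * closedForm 0 (shift a w) (suc k) - ι 0 * h (suc k) * trFirst 0 a
            ∎
        ⋆-dotSum-zeros (suc n) a k = begin
          (h ⋆ (λ j → dotSum (λ e → trCoeff (suc n) (a ∷ e)) (suc j) (zeros (suc n)))) k
            ≈⟨ ⋆-congʳ h k (λ j → dotSum-zeros (a ∷ []) (suc j) n ℕ.≤-refl) ⟩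
          (h ⋆ (λ j → ι (suc n) * trFirstLast n a (suc j))) k
            ≈⟨ ⋆-*ʳ h (ι (suc n)) _ k ⟩
          ι (suc n) * (h ⋆ (λ j → trFirstLast n a (suc j))) k
            ≈⟨ *-congˡ (⋆-tail h (trFirstLast n a) k) ⟩
          ι (suc n) * ((h ⋆ trFirstLast n a) (suc k) - h (suc k) * trFirstLast n a 0)
            ≈⟨ *-congˡ (+-cong (trFirstLast-closed n a (suc k)) (-‿cong (*-congˡ (reflexive (trFirstLast-zero n a))))) ⟩
          ι (suc n) * (ι (n !) * closedForm (suc n) (shift a w) (suc k) - h (suc k) * trFirst (suc n) a)
            ≈⟨ solve 5 (λ x y z u g → x :* (y :* z :- u :* g) := (x :* y) :* z :- x :* u :* g) refl _ _ _ _ _ ⟩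
          (ι (suc n) * ι (n !)) * closedForm (suc n) (shift a w) (suc k) - ι (suc n) * h (suc k) * trFirst (suc n) a
            ≈⟨ +-congʳ (*-congʳ (ι-* (suc n) (n !))) ⟨
          ι (suc n !) * closedForm (suc n) (shift a w) (suc k) - ι (suc n) * h (suc k) * trFirst (suc n) a ∎

      coeff-lhs : ∀ n k → coeff R d (trIter R p (suc n) (∂D R h (suc (suc n)) k)) ≈ (h ⋆ trFirstLast n 0) k
      coeff-lhs n k = trans (coeff-trIter (suc n) (∂D R h (suc (suc n)) k))
        (extend-applyUpTo (trCoeff (suc n)) (λ j → h (k ∸ j)) (λ j → replicate (suc n) 0 ++ j ∷ []) (λ j → j) (suc k))

      extend-∂S : ∀ m → extend (δ d) (∂S R h m) ≈ (h ⋆ w) m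
      extend-∂S m = extend-applyUpTo (δ d) (λ j → h (m ∸ j)) (λ j → j ∷ []) (λ j → j) (suc m)

      coeff-rhs : ∀ n k → coeff R d (rhs R h (suc (suc n)) k) ≈ ι (n !) * closedForm (suc n) w k
      coeff-rhs n k = begin
        coeff R d (rhs R h (suc (suc n)) k)
          ≈⟨ coeff≈extend-δ d (rhs R h (suc (suc n)) k) ⟩
        extend (δ d) (rhs R h (suc (suc n)) k)
          ≈⟨ extend-scale (δ d) (ι (n !)) (concatMap term (map (λ t → 2 ℕ.+ t) (upTo (suc n)))) ⟩
        ι (n !) * extend (δ d) (concatMap term (map (λ t → 2 ℕ.+ t) (upTo (suc n))))
          ≡⟨ ≡.cong (λ l → ι (n !) * extend (δ d) (concatMap term l)) (map-applyUpTo (λ t → t) (λ t → 2 ℕ.+ t) (suc n)) ⟩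
        ι (n !) * extend (δ d) (concatMap term (applyUpTo (λ t → 2 ℕ.+ t) (suc n)))
          ≈⟨ *-congˡ (trans (extend-concatMap-applyUpTo (δ d) term _ (suc n)) (∑-cong (suc n) term≈closedTerm)) ⟩
        ι (n !) * closedForm (suc n) w k                                     ∎
        where
        term : ℕ → Mod R
        term i = scale R (ι (i ∸ 1) * h (suc (suc n) ∸ i)) (∂S R h (k ℕ.+ i ∸ 1))
              ++ scale R ((ι (k ℕ.+ i) - ι (suc (suc n))) * h (k ℕ.+ i ∸ 1)) (∂S R h (suc (suc n) ∸ i))

        term≈closedTerm : ∀ t → extend (δ d) (term (2 ℕ.+ t)) ≈ closedTerm (suc n) w k t
        term≈closedTerm t = begin
          extend (δ d) (term (2 ℕ.+ t))
            ≈⟨ trans (extend-++ (δ d) (scale R α (∂S R h i)) (scale R β (∂S R h (n ∸ t))))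
                     (+-cong (extend-scale (δ d) α (∂S R h i)) (extend-scale (δ d) β (∂S R h (n ∸ t)))) ⟩
          ι (suc t) * h (n ∸ t) * extend (δ d) (∂S R h (k ℕ.+ (2 ℕ.+ t) ∸ 1))
            + (ι (k ℕ.+ (2 ℕ.+ t)) - ι (suc (suc n))) * h (k ℕ.+ (2 ℕ.+ t) ∸ 1) * extend (δ d) (∂S R h (n ∸ t))
            ≈⟨ +-cong (*-congˡ (extend-∂S _)) (*-congˡ (extend-∂S (n ∸ t))) ⟩
          ι (suc t) * h (n ∸ t) * (h ⋆ w) (k ℕ.+ (2 ℕ.+ t) ∸ 1)
            + (ι (k ℕ.+ (2 ℕ.+ t)) - ι (suc (suc n))) * h (k ℕ.+ (2 ℕ.+ t) ∸ 1) * (h ⋆ w) (n ∸ t)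
            ≡⟨ ≡.cong (λ i → ι (suc t) * h (n ∸ t) * (h ⋆ w) (i ∸ 1) + (ι i - ι (suc (suc n))) * h (i ∸ 1) * (h ⋆ w) (n ∸ t))
                      (ℕ.+-comm k (2 ℕ.+ t)) ⟩
          closedTerm (suc n) w k t ∎
          where
          i : ℕ
          i = k ℕ.+ (2 ℕ.+ t) ∸ 1

          α β : Carrier
          α = ι (suc t) * h (n ∸ t)
          β = (ι (k ℕ.+ (2 ℕ.+ t)) - ι (suc (suc n))) * h i

theorem4p4 : ∀ {c ℓ} (R : CommutativeRing c ℓ) (h p : ℕ → CommutativeRing.Carrier R)
    → CommutativeRing._≈_ R (h 0) (CommutativeRing.1# R)
    → Newton R h p
    → ∀ (n k : ℕ) → 2 ≤ n
    → _≋_ R (trIter R p (n ∸ 1) (∂D R h n k)) (rhs R h n k)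
theorem4p4 R h p h₀≈1 newton (suc (suc n)) k (s≤s (s≤s z≤n)) d = begin
  coeff R d (trIter R p (suc n) (∂D R h (suc (suc n)) k))   ≈⟨ coeff-lhs n k ⟩
  (h ⋆ trFirstLast n 0) k                                    ≈⟨ trFirstLast-closed n 0 k ⟩
  ι (n !) * closedForm (suc n) w k                           ≈⟨ coeff-rhs n k ⟨
  coeff R d (rhs R h (suc (suc n)) k)                        ∎
  where
  open CommutativeRing R using (_*_; setoid)
  open Crossings R
  open Trace p d
  open Evaluation h h₀≈1 newton
  open ClosedForm h
  open import Relation.Binary.Reasoning.Setoid setoid
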